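{- For any connected graph $G$, $$0\le \mu_t(G)\le {\rm n}(G)-{\rm diam}(G)+1.$$
   Context: All graphs are finite, simple and undirected. ${\rm n}(G)$ is the order of $G$ and ${\rm diam}(G)$ its diameter. For $X\subseteq V(G)$, two vertices $x,y\in V(G)$ are $X$-visible if there is a shortest $x,y$-path in $G$ none of whose internal vertices lies in $X$. A set $X\subseteq V(G)$ is a total mutual-visibility set of $G$ if every two vertices of $G$ are $X$-visible. The total mutual-visibility number $\mu_t(G)$ is the maximum cardinality of a total mutual-visibility set of $G$. -}

module Defs where

open import Data.Nat using (ℕ; zero; suc; _≤_)
open import Data.Fin using (Fin)
open import Data.Fin.Subset using (Subset; _∈_; ∣_∣)
open import Data.Bool using (Bool; true; false)
open import Data.Product using (Σ; ∃; ∃-syntax; _×_; _,_)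
open import Data.Unit using (⊤)
open import Relation.Nullary using (¬_)
open import Relation.Binary.PropositionalEquality using (_≡_)

record Graph (n : ℕ) : Set where
  field
    adj   : Fin n → Fin n → Bool
    sym   : ∀ x y → adj x y ≡ adj y x
    irref : ∀ x → adj x x ≡ false
open Graph public

Adj : ∀ {n} → Graph n → Fin n → Fin n → Set
Adj G x y = adj G x y ≡ true

data Walk {n : ℕ} (G : Graph n) : Fin n → Fin n → Set where
  nil  : ∀ {x} → Walk G x x
  cons : ∀ {x y z} → Adj G x y → Walk G y z → Walk G x z

len : ∀ {n} {G : Graph n} {x y} → Walk G x y → ℕ
len nil        = zero
len (cons _ w) = suc (len w)

AvoidsInner : ∀ {n} {G : Graph n} {x y} → Subset n → Walk G x y → Set
AvoidsInner X nil = ⊤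
AvoidsInner X (cons _ nil) = ⊤
AvoidsInner X (cons {y = v} _ (cons e w)) = (¬ (v ∈ X)) × AvoidsInner X (cons e w)

Connected : ∀ {n} → Graph n → Set
Connected G = ∀ x y → Walk G x y

Dist : ∀ {n} → Graph n → Fin n → Fin n → ℕ → Set
Dist G x y d = (Σ (Walk G x y) λ w → len w ≡ d) × (∀ (w : Walk G x y) → d ≤ len w)

ShortestPath : ∀ {n} (G : Graph n) (x y : Fin n) → Walk G x y → Set
ShortestPath G x y w = Dist G x y (len w)

IsDiam : ∀ {n} → Graph n → ℕ → Set
IsDiam {n} G D = (∃[ x ] ∃[ y ] Dist G x y D)
               × (∀ x y d → Dist G x y d → d ≤ D)

Visible : ∀ {n} (G : Graph n) → Subset n → Fin n → Fin n → Set
Visible G X x y = Σ (Walk G x y) λ w → ShortestPath G x y w × AvoidsInner X w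

IsTotalMutVis : ∀ {n} → Graph n → Subset n → Set
IsTotalMutVis G X = ∀ x y → Visible G X x y

IsMuT : ∀ {n} → Graph n → ℕ → Set
IsMuT {n} G m = (Σ (Subset n) λ X → IsTotalMutVis G X × ∣ X ∣ ≡ m)
              × (∀ X → IsTotalMutVis G X → ∣ X ∣ ≤ m)

-- A shortest path between two vertices at distance diam(G) = D has D − 1 distinct
-- internal vertices, and if X is a total mutual-visibility set such a path can be
-- chosen with none of them in X. Hence |X| + (D − 1) ≤ n(G).
module Submission where

open import Defs
open import Data.Nat using (ℕ; _≤_; _+_; _∸_; zero; suc; pred; _<_; z≤n; s≤s)
open import Data.Nat.Properties
  using (≤-refl; ≤-trans; n≮n; ≤-antisym; ≤-reflexive; n≤1+n; m≤m+n; +-comm; m+n≤o⇒m≤o∸n; m≤o∸n⇒m+n≤o)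
open import Data.Fin using (Fin)
open import Data.Fin.Subset using (Subset; ∣_∣; _∉_; _-_) renaming (_∈_ to _∈ₛ_)
open import Data.Fin.Subset.Properties using (∣p∣≤n; ∣∁p∣≡n∸∣p∣; x∉p⇒x∈∁p; x∈p∧x≢y⇒x∈p-y; x∈p⇒∣p-x∣<∣p∣)
open import Data.List using (List; []; _∷_; length)
open import Data.List.Membership.Propositional using (_∈_)
open import Data.List.Relation.Unary.Any using (here; there)
open import Data.List.Relation.Unary.All as All using (All; []; _∷_)
open import Data.List.Relation.Unary.All.Properties using (¬Any⇒All¬)
open import Data.List.Relation.Unary.Unique.Propositional using (Unique; []; _∷_)
open import Data.Product using (_×_; Σ; _,_; proj₂)
open import Relation.Nullary using (¬_)
open import Relation.Binary.PropositionalEquality using (_≡_; refl; cong; subst; ≢-sym)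

unique⇒length≤∣p∣ : ∀ {n} {xs : List (Fin n)} {p : Subset n} →
                    Unique xs → All (_∈ₛ p) xs → length xs ≤ ∣ p ∣
unique⇒length≤∣p∣ [] [] = z≤n
unique⇒length≤∣p∣ {xs = x ∷ xs} {p} (x≢xs ∷ xs!) (x∈p ∷ xs⊆p) =
  ≤-trans (s≤s (unique⇒length≤∣p∣ xs! xs⊆p-x)) (x∈p⇒∣p-x∣<∣p∣ x∈p)
  where
  xs⊆p-x : All (_∈ₛ p - x) xs
  xs⊆p-x = All.zipWith (λ (x≢y , y∈p) → x∈p∧x≢y⇒x∈p-y y∈p (≢-sym x≢y)) (x≢xs , xs⊆p)

unique-disjoint⇒∣p∣+length≤n : ∀ {n} {xs : List (Fin n)} (p : Subset n) →
                               Unique xs → All (_∉ p) xs → ∣ p ∣ + length xs ≤ n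
unique-disjoint⇒∣p∣+length≤n {n} {xs} p xs! xs∉p =
  subst (_≤ n) (+-comm (length xs) ∣ p ∣) (m≤o∸n⇒m+n≤o (length xs) (∣p∣≤n p) length≤n∸∣p∣)
  where
  length≤n∸∣p∣ : length xs ≤ n ∸ ∣ p ∣
  length≤n∸∣p∣ = subst (length xs ≤_) (∣∁p∣≡n∸∣p∣ p)
                   (unique⇒length≤∣p∣ xs! (All.map x∉p⇒x∈∁p xs∉p))

module _ {n : ℕ} {G : Graph n} where

  Geodesic : ∀ {x y} → Walk G x y → Set
  Geodesic {x} {y} w = ∀ (w′ : Walk G x y) → len w ≤ len w′

  geodesic-tail : ∀ {x y z} (e : Adj G x y) (w : Walk G y z) → Geodesic (cons e w) → Geodesic w
  geodesic-tail e _ geo w′ with geo (cons e w′)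
  ... | s≤s le = le

  Dist-functional : ∀ {x y d d′} → Dist G x y d → Dist G x y d′ → d ≡ d′
  Dist-functional ((w , refl) , d≤) ((w′ , refl) , d′≤) = ≤-antisym (d≤ w′) (d′≤ w)

  innerVertices : ∀ {x y} → Walk G x y → List (Fin n)
  innerVertices nil                         = []
  innerVertices (cons _ nil)                = []
  innerVertices (cons {y = v} _ (cons e w)) = v ∷ innerVertices (cons e w)

  length-innerVertices : ∀ {x y} (w : Walk G x y) → length (innerVertices w) ≡ pred (len w)
  length-innerVertices nil                 = refl
  length-innerVertices (cons _ nil)        = refl
  length-innerVertices (cons _ (cons e w)) = cong suc (length-innerVertices (cons e w))

  avoidsInner⇒innerVertices∉ : ∀ {x y} (X : Subset n) (w : Walk G x y) →
                               AvoidsInner X w → All (_∉ X) (innerVertices w)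
  avoidsInner⇒innerVertices∉ X nil                 _         = []
  avoidsInner⇒innerVertices∉ X (cons _ nil)        _         = []
  avoidsInner⇒innerVertices∉ X (cons _ (cons e w)) (v∉X , av) = v∉X ∷ avoidsInner⇒innerVertices∉ X (cons e w) av

  ∈innerVertices⇒shortcut : ∀ {x y u} (w : Walk G x y) → u ∈ innerVertices w →
                            Σ (Walk G u y) λ w′ → len w′ < len w
  ∈innerVertices⇒shortcut (cons _ (cons e w)) (here refl) = cons e w , ≤-refl
  ∈innerVertices⇒shortcut (cons _ (cons e w)) (there u∈) with ∈innerVertices⇒shortcut (cons e w) u∈
  ... | w′ , lt = w′ , ≤-trans lt (n≤1+n _)

  geodesic⇒unique-innerVertices : ∀ {x y} (w : Walk G x y) → Geodesic w → Unique (innerVertices w)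
  geodesic⇒unique-innerVertices nil                 _   = []
  geodesic⇒unique-innerVertices (cons _ nil)        _   = []
  geodesic⇒unique-innerVertices (cons d (cons e w)) geo =
    ¬Any⇒All¬ _ v∉rest ∷ geodesic⇒unique-innerVertices (cons e w) rest-geo
    where
    rest-geo : Geodesic (cons e w)
    rest-geo = geodesic-tail d (cons e w) geo

    v∉rest : ¬ (_ ∈ innerVertices (cons e w))
    v∉rest v∈ with ∈innerVertices⇒shortcut (cons e w) v∈
    ... | w′ , lt = n≮n _ (≤-trans lt (rest-geo w′))

  geodesic-avoiding⇒∣X∣+pred-len≤n : ∀ {x y} (X : Subset n) (w : Walk G x y) →
                                     Geodesic w → AvoidsInner X w → ∣ X ∣ + pred (len w) ≤ n
  geodesic-avoiding⇒∣X∣+pred-len≤n X w geo av =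
    subst (λ k → ∣ X ∣ + k ≤ n) (length-innerVertices w)
      (unique-disjoint⇒∣p∣+length≤n X (geodesic⇒unique-innerVertices w geo)
                                      (avoidsInner⇒innerVertices∉ X w av))

m∸n≤m∸[1+n]+1 : ∀ m n → m ∸ n ≤ m ∸ suc n + 1
m∸n≤m∸[1+n]+1 zero    zero    = z≤n
m∸n≤m∸[1+n]+1 zero    (suc n) = z≤n
m∸n≤m∸[1+n]+1 (suc m) zero    = ≤-reflexive (+-comm 1 m)
m∸n≤m∸[1+n]+1 (suc m) (suc n) = m∸n≤m∸[1+n]+1 m n

m+pred[n]≤o⇒m≤o∸n+1 : ∀ m n o → m + pred n ≤ o → m ≤ o ∸ n + 1
m+pred[n]≤o⇒m≤o∸n+1 m zero    o le = ≤-trans (m+n≤o⇒m≤o∸n m le) (m≤m+n o 1)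
m+pred[n]≤o⇒m≤o∸n+1 m (suc n) o le = ≤-trans (m+n≤o⇒m≤o∸n m le) (m∸n≤m∸[1+n]+1 o n)

theorem2p1 : ∀ (n : ℕ) (G : Graph n) → Connected G → ∀ (D m : ℕ) → IsDiam G D → IsMuT G m → 0 ≤ m × m ≤ (n ∸ D) + 1
theorem2p1 n G _ D m ((x , y , dist-xy) , _) ((X , tmv , refl) , _)
  with tmv x y
... | w , shortest , avoids = z≤n , m+pred[n]≤o⇒m≤o∸n+1 ∣ X ∣ D n ∣X∣+pred-D≤n
  where
  len-w≡D : len w ≡ D
  len-w≡D = Dist-functional shortest dist-xy

  ∣X∣+pred-D≤n : ∣ X ∣ + pred D ≤ n
  ∣X∣+pred-D≤n = subst (λ d → ∣ X ∣ + pred d ≤ n) len-w≡D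
                   (geodesic-avoiding⇒∣X∣+pred-len≤n X w (proj₂ shortest) avoids)
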